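{- Let $d\ge1$, let $\mathcal{B}_d$ be the complete binary matroid on $\mathbb{F}_2^d$, and let $\mathcal{P}$ be a partition matroid with (possibly empty) parts $P_1,\dots,P_d$ that is a reduction of $\mathcal{B}_d$. Let $R:=\mathbb{F}_2^d\setminus\bigcup_{i=1}^d P_i$. Then the number of pairs $(a,b)$ with $a\in P_i$, $b\in P_j$ for some $1\le i<j\le d$ and $a+b\in R$ is at most $\max_{1\le i\le d}2|P_i|\cdot|R|$.
   Context: The complete binary matroid $\mathcal{B}_d$ has ground set $\mathbb{F}_2^d$, and a set is independent iff its vectors are linearly independent over $\mathbb{F}_2$. A matroid $\mathcal{M}'=(E',\mathcal{I}')$ is a reduction of $\mathcal{M}=(E,\mathcal{I})$ if $E'\subseteq E$ and $\mathcal{I}'\subseteq\mathcal{I}$. A partition matroid with parts $P_1,\dots,P_d$ has ground set the disjoint union of the $P_i$ (parts may be empty), and $S$ is independent iff $|S\cap P_i|\le1$ for all $i$. -}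

module Defs where

open import Data.Bool using (Bool; true; false; _∧_; _xor_; not)
open import Data.Nat using (ℕ; zero; suc; _*_; _≤_; _⊔_; _<ᵇ_)
open import Data.Fin using (Fin; toℕ)
open import Data.Vec using (Vec; []; _∷_; zipWith; replicate)
open import Data.List using (List; []; _∷_; map; _++_; length; filterᵇ; foldr; allFin; cartesianProduct)
open import Data.Bool.ListAction using (any)
open import Data.List.Relation.Unary.All using (All)
open import Data.List.Relation.Unary.Unique.Propositional using (Unique)
open import Data.List.Relation.Binary.Sublist.Propositional using (_⊆_)
open import Data.Product using (_×_; _,_)
open import Relation.Binary.PropositionalEquality using (_≡_)

𝔽₂^ : ℕ → Set
𝔽₂^ d = Vec Bool d

_⊕_ : ∀ {d} → 𝔽₂^ d → 𝔽₂^ d → 𝔽₂^ d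
_⊕_ = zipWith _xor_

𝟎 : ∀ {d} → 𝔽₂^ d
𝟎 = replicate _ false

vsum : ∀ {d} → List (𝔽₂^ d) → 𝔽₂^ d
vsum = foldr _⊕_ 𝟎

allVecs : ∀ d → List (𝔽₂^ d)
allVecs zero = [] ∷ []
allVecs (suc d) = map (true ∷_) (allVecs d) ++ map (false ∷_) (allVecs d)

-- A finite set of vectors (a duplicate-free list) is linearly independent
-- over 𝔽₂ iff no nonempty sub(multi)set sums to zero (over 𝔽₂ every linear
-- combination is a subset sum).
LinIndep : ∀ {d} → List (𝔽₂^ d) → Set
LinIndep S = Unique S × (∀ T → T ⊆ S → vsum T ≡ 𝟎 → T ≡ [])

Parts : ℕ → Set
Parts d = Fin d → 𝔽₂^ d → Bool

Disjoint : ∀ {d} → Parts d → Set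
Disjoint {d} P = ∀ (i j : Fin d) (v : 𝔽₂^ d) → P i v ≡ true → P j v ≡ true → i ≡ j

inGround : ∀ {d} → Parts d → 𝔽₂^ d → Bool
inGround {d} P v = any (λ i → P i v) (allFin d)

PartIndep : ∀ {d} → Parts d → List (𝔽₂^ d) → Set
PartIndep P S = Unique S × All (λ v → inGround P v ≡ true) S
              × (∀ i → length (filterᵇ (P i) S) ≤ 1)

-- the partition matroid is a reduction of 𝓑_d: ground set ⊆ 𝔽₂^d (automatic,
-- given disjointness) and every partition-independent set is linearly independent
IsReduction : ∀ {d} → Parts d → Set
IsReduction P = ∀ S → PartIndep P S → LinIndep S

inR : ∀ {d} → Parts d → 𝔽₂^ d → Bool
inR P v = not (inGround P v)

partSize : ∀ {d} → Parts d → Fin d → ℕ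
partSize {d} P i = length (filterᵇ (P i) (allVecs d))

sizeR : ∀ {d} → Parts d → ℕ
sizeR {d} P = length (filterᵇ (inR P) (allVecs d))

goodPair : ∀ {d} → Parts d → 𝔽₂^ d × 𝔽₂^ d → Bool
goodPair {d} P (a , b) =
  any (λ i → any (λ j → (toℕ i <ᵇ toℕ j) ∧ (P i a ∧ P j b)) (allFin d)) (allFin d)
  ∧ inR P (a ⊕ b)

pairCount : ∀ {d} → Parts d → ℕ
pairCount {d} P = length (filterᵇ (goodPair P) (cartesianProduct (allVecs d) (allVecs d)))

maxTwicePart : ∀ {d} → Parts d → ℕ
maxTwicePart {d} P = foldr _⊔_ 0 (map (λ i → 2 * partSize P i) (allFin d))

-- Fix r ∈ R and a good pair (a₀, b₀) with a₀ ∈ P_i, b₀ ∈ P_j and a₀ + b₀ = r.  If another good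
-- pair (a, b) with a + b = r had neither a nor b in P_i ∪ P_j, then a₀, b₀, a, b would lie in four
-- distinct parts, hence be independent in the partition matroid, yet sum to 0 — impossible in a
-- reduction of 𝓑_d.  So every good pair with sum r has an entry in P_i ∪ P_j; that entry determines
-- the pair (the other entry is r minus it, and i < j fixes the order), so there are at most
-- |P_i| + |P_j| ≤ max_k 2|P_k| such pairs.  Summing over r ∈ R gives the bound.
module Submission where

open import Defs
open import Algebra.Properties.CommutativeSemigroup using (interchange)
open import Data.Bool using (Bool; true; false; _∧_; _∨_; T; if_then_else_)
open import Data.Bool.Properties
  using (xor-assoc; xor-comm; xor-same; xor-identityˡ; xor-identityʳ; ∧-conicalˡ; ∧-conicalʳ; ∨-conicalˡ; ∨-conicalʳ; T-≡; T-∧)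
  renaming (_≟_ to _≟ᵇ_)
open import Data.Bool.ListAction using (any)
open import Data.Fin using (Fin; toℕ; _<_)
open import Data.Fin.Properties using (<⇒≢; <-asym)
open import Data.List using (List; []; _∷_; [_]; map; _++_; length; filterᵇ; foldr; allFin; cartesianProduct)
open import Data.List.Membership.Propositional using (_∈_)
open import Data.List.Membership.Propositional.Properties
  using (∈-map⁺; ∈-map⁻; ∈-++⁺ˡ; ∈-++⁺ʳ; ∈-++⁻; ∈-∃++; ∈-allFin; ∈-filter⁺; ∈-filter⁻)
open import Data.List.Properties using (length-map; length-++; map-cong; filter-none)
open import Data.List.Relation.Binary.Sublist.Propositional using (⊆-refl)
open import Data.List.Relation.Unary.All as All using (All; []; _∷_)
import Data.List.Relation.Unary.All.Properties as All
open import Data.List.Relation.Unary.AllPairs using ([]; _∷_)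
import Data.List.Relation.Unary.AllPairs as AllPairs
import Data.List.Relation.Unary.AllPairs.Properties as AllPairs
open import Data.List.Relation.Unary.Any using (here; there)
open import Data.List.Relation.Unary.Unique.Propositional using (Unique)
import Data.List.Relation.Unary.Unique.Propositional.Properties as Unique
open import Data.Nat using (ℕ; suc; _+_; _*_; _≤_; _<ᵇ_; _⊔_; z≤n; s≤s)
open import Data.Nat.ListAction using (sum)
open import Data.Nat.Properties
  using (≤-trans; ≤-reflexive; n≤1+n; m≤n+m; m≤m⊔n; m≤n⊔m; <ᵇ⇒<; +-suc; +-identityʳ; *-identityʳ; +-mono-≤;
         +-monoʳ-≤; *-distribˡ-+; *-cancelˡ-≤; +-commutativeSemigroup; module ≤-Reasoning)
open import Data.Product using (Σ-syntax; ∃; ∃₂; _×_; _,_; proj₁; proj₂; uncurry)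
open import Data.Sum using (inj₁; inj₂)
open import Data.Vec using ([]; _∷_)
import Data.Vec.Properties as Vec
open import Data.Empty using (⊥; ⊥-elim)
open import Function using (_∘_)
open import Function.Bundles using (module Equivalence)
open import Relation.Binary.Definitions using (DecidableEquality)
open import Relation.Binary.PropositionalEquality hiding ([_])
open import Relation.Nullary using (yes; no; contradiction)
open import Relation.Nullary.Decidable using (⌊_⌋; T?; toWitness)
open import Relation.Unary using (∁)

≡true⇒T : ∀ {b} → b ≡ true → T b
≡true⇒T = Equivalence.from T-≡

T⇒≡true : ∀ {b} → T b → b ≡ true
T⇒≡true = Equivalence.to T-≡

⊕-assoc : ∀ {d} (x y z : 𝔽₂^ d) → (x ⊕ y) ⊕ z ≡ x ⊕ (y ⊕ z)
⊕-assoc = Vec.zipWith-assoc xor-assoc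

⊕-comm : ∀ {d} (x y : 𝔽₂^ d) → x ⊕ y ≡ y ⊕ x
⊕-comm = Vec.zipWith-comm xor-comm

⊕-identityˡ : ∀ {d} (x : 𝔽₂^ d) → 𝟎 ⊕ x ≡ x
⊕-identityˡ = Vec.zipWith-identityˡ xor-identityˡ

⊕-identityʳ : ∀ {d} (x : 𝔽₂^ d) → x ⊕ 𝟎 ≡ x
⊕-identityʳ = Vec.zipWith-identityʳ xor-identityʳ

⊕-self : ∀ {d} (x : 𝔽₂^ d) → x ⊕ x ≡ 𝟎
⊕-self []      = refl
⊕-self (b ∷ x) = cong₂ _∷_ (xor-same b) (⊕-self x)

⊕-cancelˡ : ∀ {d} (x : 𝔽₂^ d) {y z} → x ⊕ y ≡ x ⊕ z → y ≡ z
⊕-cancelˡ x {y} {z} eq = begin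
  y             ≡⟨ ⊕-identityˡ y ⟨
  𝟎 ⊕ y         ≡⟨ cong (_⊕ y) (⊕-self x) ⟨
  (x ⊕ x) ⊕ y   ≡⟨ ⊕-assoc x x y ⟩
  x ⊕ (x ⊕ y)   ≡⟨ cong (x ⊕_) eq ⟩
  x ⊕ (x ⊕ z)   ≡⟨ ⊕-assoc x x z ⟨
  (x ⊕ x) ⊕ z   ≡⟨ cong (_⊕ z) (⊕-self x) ⟩
  𝟎 ⊕ z         ≡⟨ ⊕-identityˡ z ⟩
  z             ∎
  where open ≡-Reasoning

⊕-cancelʳ : ∀ {d} {x y} (z : 𝔽₂^ d) → x ⊕ z ≡ y ⊕ z → x ≡ y
⊕-cancelʳ {x = x} {y} z eq = ⊕-cancelˡ z (trans (⊕-comm z x) (trans eq (⊕-comm y z)))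

_≟ᵛ_ : ∀ {d} → DecidableEquality (𝔽₂^ d)
_≟ᵛ_ = Vec.≡-dec _≟ᵇ_

∈-allVecs : ∀ {d} (v : 𝔽₂^ d) → v ∈ allVecs d
∈-allVecs []          = here refl
∈-allVecs (true ∷ v)  = ∈-++⁺ˡ (∈-map⁺ (true ∷_) (∈-allVecs v))
∈-allVecs (false ∷ v) = ∈-++⁺ʳ _ (∈-map⁺ (false ∷_) (∈-allVecs v))

vecPairs : ∀ d → List (𝔽₂^ d × 𝔽₂^ d)
vecPairs d = cartesianProduct (allVecs d) (allVecs d)

allVecs-unique : ∀ d → Unique (allVecs d)
allVecs-unique ℕ.zero    = [] ∷ []
allVecs-unique (suc d) =
  Unique.++⁺ (Unique.map⁺ ∷-injectiveʳ (allVecs-unique d)) (Unique.map⁺ ∷-injectiveʳ (allVecs-unique d)) heads-differ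
  where
  ∷-injectiveʳ : ∀ {b} {x y : 𝔽₂^ d} → b ∷ x ≡ b ∷ y → x ≡ y
  ∷-injectiveʳ refl = refl
  heads-differ : ∀ {v} → v ∈ map (true ∷_) (allVecs d) × v ∈ map (false ∷_) (allVecs d) → ⊥
  heads-differ (m , m′) with ∈-map⁻ (true ∷_) m | ∈-map⁻ (false ∷_) m′
  ... | _ , _ , refl | _ , _ , ()

iverson : Bool → ℕ
iverson true  = 1
iverson false = 0

countᵇ : ∀ {A : Set} → (A → Bool) → List A → ℕ
countᵇ p xs = length (filterᵇ p xs)

_∪ᵇ_ : ∀ {A : Set} → (A → Bool) → (A → Bool) → A → Bool
(p ∪ᵇ q) x = p x ∨ q x

module _ {A : Set} where

  countᵇ-∷ : ∀ (p : A → Bool) x xs → countᵇ p (x ∷ xs) ≡ iverson (p x) + countᵇ p xs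
  countᵇ-∷ p x xs with p x
  ... | true  = refl
  ... | false = refl

  countᵇ-∪ᵇ : ∀ (p q : A → Bool) xs → countᵇ (p ∪ᵇ q) xs ≤ countᵇ p xs + countᵇ q xs
  countᵇ-∪ᵇ p q []       = z≤n
  countᵇ-∪ᵇ p q (x ∷ xs) with p x | q x | countᵇ-∪ᵇ p q xs
  ... | true  | true  | ih = s≤s (≤-trans ih (+-monoʳ-≤ (countᵇ p xs) (n≤1+n _)))
  ... | true  | false | ih = s≤s ih
  ... | false | true  | ih = ≤-trans (s≤s ih) (≤-reflexive (sym (+-suc _ _)))
  ... | false | false | ih = ih

  length-≤-of-Unique-⊆ : {xs ys : List A} → Unique xs → (∀ {x} → x ∈ xs → x ∈ ys) → length xs ≤ length ys
  length-≤-of-Unique-⊆ {[]}     _          _   = z≤n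
  length-≤-of-Unique-⊆ {x ∷ xs} (x∉ ∷ xs!) xs⊆ with us , ws , refl ← ∈-∃++ (xs⊆ (here refl)) = begin
    suc (length xs)                ≤⟨ s≤s (length-≤-of-Unique-⊆ xs! xs⊆us++ws) ⟩
    suc (length (us ++ ws))        ≡⟨ cong suc (length-++ us) ⟩
    suc (length us + length ws)    ≡⟨ +-suc (length us) (length ws) ⟨
    length us + length (x ∷ ws)    ≡⟨ length-++ us ⟨
    length (us ++ [ x ] ++ ws)     ∎
    where
    open ≤-Reasoning
    drop-x : ∀ {y} → y ≢ x → y ∈ us ++ [ x ] ++ ws → y ∈ us ++ ws
    drop-x y≢x m with ∈-++⁻ us m
    ... | inj₁ m′         = ∈-++⁺ˡ m′
    ... | inj₂ (here y≡x) = contradiction y≡x y≢x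
    ... | inj₂ (there m′) = ∈-++⁺ʳ us m′
    xs⊆us++ws : ∀ {y} → y ∈ xs → y ∈ us ++ ws
    xs⊆us++ws m = drop-x (All.lookup x∉ m ∘ sym) (xs⊆ (there m))

module _ {A B : Set} (g : A → B) where

  Unique-map⁺-locally-injective : ∀ {xs} → Unique xs → (∀ {x y} → x ∈ xs → y ∈ xs → g x ≡ g y → x ≡ y) →
                                  Unique (map g xs)
  Unique-map⁺-locally-injective {[]}     []         _   = []
  Unique-map⁺-locally-injective {x ∷ xs} (x∉ ∷ xs!) inj =
    All.map⁺ (All.tabulate λ m gx≡gy → All.lookup x∉ m (inj (here refl) (there m) gx≡gy))
    ∷ Unique-map⁺-locally-injective xs! (λ m m′ → inj (there m) (there m′))

  length-≤-of-injection : ∀ {xs ys} → Unique xs → (∀ {x y} → x ∈ xs → y ∈ xs → g x ≡ g y → x ≡ y) →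
                          (∀ {x} → x ∈ xs → g x ∈ ys) → length xs ≤ length ys
  length-≤-of-injection {xs} xs! inj into =
    subst (_≤ _) (length-map g xs) (length-≤-of-Unique-⊆ (Unique-map⁺-locally-injective xs! inj) image⊆)
    where
    image⊆ : ∀ {y} → y ∈ map g xs → y ∈ _
    image⊆ m with _ , x∈ , refl ← ∈-map⁻ g m = into x∈

sum-map-+ : ∀ {A : Set} (f g : A → ℕ) xs → sum (map (λ x → f x + g x) xs) ≡ sum (map f xs) + sum (map g xs)
sum-map-+ f g []       = refl
sum-map-+ f g (x ∷ xs) =
  trans (cong (f x + g x +_) (sum-map-+ f g xs)) (interchange +-commutativeSemigroup (f x) (g x) _ _)

sum-≤-*-countᵇ : ∀ {A : Set} (c : A → ℕ) (t : A → Bool) M → (∀ x → c x ≤ M * iverson (t x)) →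
                 ∀ xs → sum (map c xs) ≤ M * countᵇ t xs
sum-≤-*-countᵇ c t M c≤ []       = z≤n
sum-≤-*-countᵇ c t M c≤ (x ∷ xs) = begin
  c x + sum (map c xs)                   ≤⟨ +-mono-≤ (c≤ x) (sum-≤-*-countᵇ c t M c≤ xs) ⟩
  M * iverson (t x) + M * countᵇ t xs    ≡⟨ *-distribˡ-+ M (iverson (t x)) _ ⟨
  M * (iverson (t x) + countᵇ t xs)      ≡⟨ cong (M *_) (countᵇ-∷ t x xs) ⟨
  M * countᵇ t (x ∷ xs)                  ∎
  where open ≤-Reasoning

module _ {A B : Set} (_≟B_ : DecidableEquality B) (p : A → Bool) (f : A → B) where

  fibre : B → A → Bool
  fibre r x = p x ∧ ⌊ f x ≟B r ⌋

  iverson-≤-sum-fibres : ∀ {U} x → f x ∈ U → iverson (p x) ≤ sum (map (λ r → iverson (fibre r x)) U)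
  iverson-≤-sum-fibres x fx∈U with p x
  ... | false = z≤n
  ... | true  = hit fx∈U
    where
    hit : ∀ {U} → f x ∈ U → 1 ≤ sum (map (λ r → iverson ⌊ f x ≟B r ⌋) U)
    hit (here refl) with f x ≟B f x
    ... | yes _    = s≤s z≤n
    ... | no fx≢fx = contradiction refl fx≢fx
    hit (there m) = ≤-trans (hit m) (m≤n+m _ _)

  countᵇ-≤-sum-fibres : ∀ {U} → (∀ x → f x ∈ U) → ∀ xs → countᵇ p xs ≤ sum (map (λ r → countᵇ (fibre r) xs) U)
  countᵇ-≤-sum-fibres f∈U []       = z≤n
  countᵇ-≤-sum-fibres {U} f∈U (x ∷ xs) = begin
    countᵇ p (x ∷ xs)
      ≡⟨ countᵇ-∷ p x xs ⟩
    iverson (p x) + countᵇ p xs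
      ≤⟨ +-mono-≤ (iverson-≤-sum-fibres x (f∈U x)) (countᵇ-≤-sum-fibres f∈U xs) ⟩
    sum (map (λ r → iverson (fibre r x)) U) + sum (map (λ r → countᵇ (fibre r) xs) U)
      ≡⟨ sum-map-+ _ _ U ⟨
    sum (map (λ r → iverson (fibre r x) + countᵇ (fibre r) xs) U)
      ≡⟨ cong sum (map-cong (λ r → countᵇ-∷ (fibre r) x xs) U) ⟨
    sum (map (λ r → countᵇ (fibre r) (x ∷ xs)) U)
      ∎
    where open ≤-Reasoning

∈⇒≤-foldr-⊔ : ∀ {A : Set} (h : A → ℕ) {x xs} → x ∈ xs → h x ≤ foldr _⊔_ 0 (map h xs)
∈⇒≤-foldr-⊔ h (here refl) = m≤m⊔n _ _
∈⇒≤-foldr-⊔ h {xs = y ∷ _} (there m) = ≤-trans (∈⇒≤-foldr-⊔ h m) (m≤n⊔m (h y) _)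

2*m≤o⇒2*n≤o⇒m+n≤o : ∀ {m n o} → 2 * m ≤ o → 2 * n ≤ o → m + n ≤ o
2*m≤o⇒2*n≤o⇒m+n≤o {m} {n} {o} 2m≤o 2n≤o = *-cancelˡ-≤ 2 (begin
  2 * (m + n)      ≡⟨ *-distribˡ-+ 2 m n ⟩
  2 * m + 2 * n    ≤⟨ +-mono-≤ 2m≤o 2n≤o ⟩
  o + o            ≡⟨ cong (o +_) (+-identityʳ o) ⟨
  2 * o            ∎)
  where open ≤-Reasoning

any-elim : ∀ {A : Set} (f : A → Bool) xs → any f xs ≡ true → ∃ λ x → f x ≡ true
any-elim f (x ∷ xs) h with f x in fx
... | true  = x , fx
... | false = any-elim f xs h

any-intro : ∀ {A : Set} (f : A → Bool) {x xs} → x ∈ xs → f x ≡ true → any f xs ≡ true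
any-intro f (here refl) fx rewrite fx = refl
any-intro f {xs = y ∷ _} (there m) fx with f y
... | true  = refl
... | false = any-intro f m fx

module Partition {d} (P : Parts d) (disj : Disjoint P) where

  SplitIn : Fin d → Fin d → 𝔽₂^ d → 𝔽₂^ d → Set
  SplitIn i j a b = i < j × P i a ≡ true × P j b ≡ true

  SplitPair : 𝔽₂^ d → 𝔽₂^ d → Set
  SplitPair a b = ∃₂ λ i j → SplitIn i j a b

  splitᵇ : 𝔽₂^ d → 𝔽₂^ d → Fin d → Fin d → Bool
  splitᵇ a b i j = (toℕ i <ᵇ toℕ j) ∧ (P i a ∧ P j b)

  someSplitᵇ : 𝔽₂^ d → 𝔽₂^ d → Bool
  someSplitᵇ a b = any (λ i → any (splitᵇ a b i) (allFin d)) (allFin d)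

  goodPair⇒SplitPair : ∀ {a b} → goodPair P (a , b) ≡ true → SplitPair a b
  goodPair⇒SplitPair {a} {b} good
    with i , some-j ← any-elim (λ i → any (splitᵇ a b i) (allFin d)) (allFin d)
                        (∧-conicalˡ (someSplitᵇ a b) _ good)
    with j , ij ← any-elim (splitᵇ a b i) (allFin d) some-j
    with i<j , ia∧jb ← ∧-conicalˡ (toℕ i <ᵇ toℕ j) _ ij , ∧-conicalʳ (toℕ i <ᵇ toℕ j) _ ij
    = i , j , <ᵇ⇒< (toℕ i) (toℕ j) (≡true⇒T i<j) , ∧-conicalˡ (P i a) _ ia∧jb , ∧-conicalʳ (P i a) _ ia∧jb

  goodPair⇒inR : ∀ {a b} → goodPair P (a , b) ≡ true → inR P (a ⊕ b) ≡ true
  goodPair⇒inR {a} {b} good = ∧-conicalʳ (someSplitᵇ a b) _ good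

  SplitPair-asym : ∀ {a b} → SplitPair a b → SplitPair b a → ⊥
  SplitPair-asym {a} {b} (i , j , i<j , ia , jb) (k , l , k<l , kb , la)
    with refl ← disj i l a ia la | refl ← disj j k b jb kb = <-asym i<j k<l

  parts-differ : ∀ {i j v} → P i v ≡ false → P j v ≡ true → i ≢ j
  parts-differ iv jv refl = contradiction (trans (sym iv) jv) λ ()

  Tagged : Set
  Tagged = Σ[ i ∈ Fin d ] Σ[ v ∈ 𝔽₂^ d ] P i v ≡ true

  part : Tagged → Fin d
  part = proj₁

  vector : Tagged → 𝔽₂^ d
  vector = proj₁ ∘ proj₂

  PartIndep-of-distinct-parts : ∀ ws → Unique (map part ws) → PartIndep P (map vector ws)
  PartIndep-of-distinct-parts ws parts! =
    AllPairs.map⁺ (AllPairs.map (λ {x y} → distinct-vectors {x} {y}) (AllPairs.map⁻ parts!)) ,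
    All.map⁺ (All.universal (λ (i , _ , iv) → any-intro _ (∈-allFin i) iv) ws) ,
    λ n → at-most-one n ws parts!
    where
    distinct-vectors : ∀ {x y : Tagged} → part x ≢ part y → vector x ≢ vector y
    distinct-vectors {i , v , iv} {j , .v , jv} i≢j refl = i≢j (disj i j v iv jv)

    at-most-one : ∀ n ws → Unique (map part ws) → countᵇ (P n) (map vector ws) ≤ 1
    at-most-one n []                 _          = z≤n
    at-most-one n ((i , v , iv) ∷ ws) (i∉ ∷ ws!) with P n v in nv
    ... | false = at-most-one n ws ws!
    ... | true  = s≤s (≤-reflexive (cong length (filter-none (T? ∘ P n) (All.map⁺ none))))
      where
      none : All (∁ (T ∘ P n) ∘ vector) ws
      none = All.map (λ {(j , w , jw)} i≢j nw →
               i≢j (trans (sym (disj n i v nv iv)) (disj n j w (T⇒≡true nw) jw)))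
             (All.map⁻ i∉)

module Reduction {d} (P : Parts d) (disj : Disjoint P) (red : IsReduction P) where
  open Partition P disj

  distinct-parts-zero-sum⇒[] : ∀ ws → Unique (map part ws) → vsum (map vector ws) ≡ 𝟎 → map vector ws ≡ []
  distinct-parts-zero-sum⇒[] ws parts! = proj₂ (red _ (PartIndep-of-distinct-parts ws parts!)) _ ⊆-refl

  SplitPairs-with-equal-sum-meet : ∀ {i₀ j₀ a₀ b₀ a b} → SplitIn i₀ j₀ a₀ b₀ → SplitPair a b →
                                   a₀ ⊕ b₀ ≡ a ⊕ b → (P i₀ ∪ᵇ P j₀) a ∨ (P i₀ ∪ᵇ P j₀) b ≡ true
  SplitPairs-with-equal-sum-meet {i₀} {j₀} {a₀} {b₀} {a} {b} (i₀<j₀ , i₀a₀ , j₀b₀) (i , j , i<j , ia , jb) sums≡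
    with (P i₀ ∪ᵇ P j₀) a ∨ (P i₀ ∪ᵇ P j₀) b in meets
  ... | true  = refl
  ... | false = contradiction (distinct-parts-zero-sum⇒[] ws parts! zero-sum) λ ()
    where
    a∉ : (P i₀ ∪ᵇ P j₀) a ≡ false
    a∉ = ∨-conicalˡ ((P i₀ ∪ᵇ P j₀) a) _ meets
    b∉ : (P i₀ ∪ᵇ P j₀) b ≡ false
    b∉ = ∨-conicalʳ ((P i₀ ∪ᵇ P j₀) a) _ meets

    ws : List Tagged
    ws = (i₀ , a₀ , i₀a₀) ∷ (j₀ , b₀ , j₀b₀) ∷ (i , a , ia) ∷ (j , b , jb) ∷ []

    parts! : Unique (i₀ ∷ j₀ ∷ i ∷ j ∷ [])
    parts! = (<⇒≢ i₀<j₀ ∷ parts-differ (∨-conicalˡ (P i₀ a) _ a∉) ia ∷ parts-differ (∨-conicalˡ (P i₀ b) _ b∉) jb ∷ [])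
           ∷ (parts-differ (∨-conicalʳ (P i₀ a) _ a∉) ia ∷ parts-differ (∨-conicalʳ (P i₀ b) _ b∉) jb ∷ [])
           ∷ (<⇒≢ i<j ∷ [])
           ∷ []
           ∷ []

    zero-sum : a₀ ⊕ (b₀ ⊕ (a ⊕ (b ⊕ 𝟎))) ≡ 𝟎
    zero-sum = begin
      a₀ ⊕ (b₀ ⊕ (a ⊕ (b ⊕ 𝟎)))   ≡⟨ cong (λ t → a₀ ⊕ (b₀ ⊕ (a ⊕ t))) (⊕-identityʳ b) ⟩
      a₀ ⊕ (b₀ ⊕ (a ⊕ b))         ≡⟨ ⊕-assoc a₀ b₀ (a ⊕ b) ⟨
      (a₀ ⊕ b₀) ⊕ (a ⊕ b)         ≡⟨ cong (_⊕ (a ⊕ b)) sums≡ ⟩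
      (a ⊕ b) ⊕ (a ⊕ b)           ≡⟨ ⊕-self (a ⊕ b) ⟩
      𝟎                           ∎
      where open ≡-Reasoning

  SplitPairWithSum : 𝔽₂^ d → 𝔽₂^ d × 𝔽₂^ d → Set
  SplitPairWithSum r (a , b) = SplitPair a b × a ⊕ b ≡ r

  fibre-length-≤ : ∀ {r i₀ j₀ a₀ b₀} → SplitIn i₀ j₀ a₀ b₀ → a₀ ⊕ b₀ ≡ r → ∀ G → Unique G →
                   (∀ {x} → x ∈ G → SplitPairWithSum r x) → length G ≤ partSize P i₀ + partSize P j₀
  fibre-length-≤ {r} {i₀} {j₀} split₀ sum₀ G G! G⊆fibre =
    ≤-trans (length-≤-of-injection select G! injective into) (countᵇ-∪ᵇ (P i₀) (P j₀) (allVecs d))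
    where
    Q : 𝔽₂^ d → Bool
    Q = P i₀ ∪ᵇ P j₀

    select : 𝔽₂^ d × 𝔽₂^ d → 𝔽₂^ d
    select (a , b) = if Q a then a else b

    into : ∀ {x} → x ∈ G → select x ∈ filterᵇ Q (allVecs d)
    into {a , b} x∈ with Q a in Qa
    ... | true  = ∈-filter⁺ (T? ∘ Q) (∈-allVecs a) (≡true⇒T Qa)
    ... | false = ∈-filter⁺ (T? ∘ Q) (∈-allVecs b) (≡true⇒T (subst (λ t → t ∨ Q b ≡ true) Qa meets))
      where
      meets : Q a ∨ Q b ≡ true
      meets = SplitPairs-with-equal-sum-meet split₀ (proj₁ (G⊆fibre x∈)) (trans sum₀ (sym (proj₂ (G⊆fibre x∈))))

    injective : ∀ {x y} → x ∈ G → y ∈ G → select x ≡ select y → x ≡ y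
    injective {a , b} {a′ , b′} x∈ y∈ same with G⊆fibre x∈ | G⊆fibre y∈ | Q a | Q a′
    ... | _ , ab≡r | _ , a′b′≡r | true | true with refl ← same =
      cong (a ,_) (⊕-cancelˡ a (trans ab≡r (sym a′b′≡r)))
    ... | _ , ab≡r | _ , a′b′≡r | false | false with refl ← same =
      cong (_, b) (⊕-cancelʳ b (trans ab≡r (sym a′b′≡r)))
    ... | split , ab≡r | split′ , a′b′≡r | true | false with refl ← same
      with refl ← ⊕-cancelˡ a (trans ab≡r (trans (sym a′b′≡r) (⊕-comm a′ a))) = ⊥-elim (SplitPair-asym split split′)
    ... | split , ab≡r | split′ , a′b′≡r | false | true with refl ← same
      with refl ← ⊕-cancelˡ a′ (trans a′b′≡r (trans (sym ab≡r) (⊕-comm a a′))) = ⊥-elim (SplitPair-asym split′ split)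

  fibre-length-≤-max : ∀ r G → Unique G → (∀ {x} → x ∈ G → goodPair P x ≡ true × uncurry _⊕_ x ≡ r) →
                       length G ≤ maxTwicePart P * iverson (inR P r)
  fibre-length-≤-max r []              _  _      = z≤n
  fibre-length-≤-max r G@((a₀ , b₀) ∷ _) G! G⊆fibre
    with good₀ , refl ← G⊆fibre (here refl)
    rewrite goodPair⇒inR good₀
    with i₀ , j₀ , split₀ ← goodPair⇒SplitPair good₀ = begin
      length G
        ≤⟨ fibre-length-≤ split₀ refl G G! (λ x∈ → goodPair⇒SplitPair (proj₁ (G⊆fibre x∈)) , proj₂ (G⊆fibre x∈)) ⟩
      partSize P i₀ + partSize P j₀
        ≤⟨ 2*m≤o⇒2*n≤o⇒m+n≤o {partSize P i₀} {partSize P j₀} (twice-part≤max i₀) (twice-part≤max j₀) ⟩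
      maxTwicePart P
        ≡⟨ *-identityʳ _ ⟨
      maxTwicePart P * 1
        ∎
    where
    open ≤-Reasoning
    twice-part≤max : ∀ i → 2 * partSize P i ≤ maxTwicePart P
    twice-part≤max i = ∈⇒≤-foldr-⊔ (λ k → 2 * partSize P k) (∈-allFin i)

  goodPairsWithSum : 𝔽₂^ d → 𝔽₂^ d × 𝔽₂^ d → Bool
  goodPairsWithSum = fibre _≟ᵛ_ (goodPair P) (uncurry _⊕_)

  count-goodPairsWithSum-≤ : ∀ r → countᵇ (goodPairsWithSum r) (vecPairs d) ≤ maxTwicePart P * iverson (inR P r)
  count-goodPairsWithSum-≤ r = fibre-length-≤-max r (filterᵇ (goodPairsWithSum r) (vecPairs d))
    (Unique.filter⁺ (T? ∘ goodPairsWithSum r) (Unique.cartesianProduct⁺ (allVecs-unique d) (allVecs-unique d)))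
    (λ x∈ → let good , sum≡r = Equivalence.to T-∧ (proj₂ (∈-filter⁻ (T? ∘ goodPairsWithSum r) {xs = vecPairs d} x∈))
            in T⇒≡true good , toWitness sum≡r)

mainTheorem2 : (d : ℕ) → 1 ≤ d → (P : Parts d) → Disjoint P → IsReduction P
    → pairCount P ≤ maxTwicePart P * sizeR P
mainTheorem2 d _ P disj red = begin
  pairCount P
    ≤⟨ countᵇ-≤-sum-fibres _≟ᵛ_ (goodPair P) (uncurry _⊕_) (∈-allVecs ∘ uncurry _⊕_) (vecPairs d) ⟩
  sum (map (λ r → countᵇ (goodPairsWithSum r) (vecPairs d)) (allVecs d))
    ≤⟨ sum-≤-*-countᵇ _ (inR P) (maxTwicePart P) count-goodPairsWithSum-≤ (allVecs d) ⟩
  maxTwicePart P * sizeR P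
    ∎
  where
  open ≤-Reasoning
  open Reduction P disj red
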